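{- Let $v_1,\dots,v_k\in\mathbb{N}^k$ be integer vectors that are linearly independent in $\mathbb{R}^k$, none of which is parallel to a coordinate axis. Let $U=\{a_1v_1+\cdots+a_kv_k : a_i\in\mathbb{R}_{\geq 0}\}$ be the cone they generate and $V=U\cap\mathbb{N}^k$. Let $S$ be the set of all integer points of the simplex $\{a_1(kv_1)+\cdots+a_k(kv_k): a_i\geq 0,\ a_1+\cdots+a_k\leq 1\}$, let $X_i=\{v_i,2v_i,4v_i,8v_i,\dots\}=\{2^jv_i: j\geq 0\}$ for $i=1,\dots,k$, and let $X=S\cup X_1\cup\cdots\cup X_k$. Then $V=FS(X)$, and $X$ is thin: there is a constant $t_X$ such that $|X\cap[1,N]^k|\leq \log_2|V\cap[1,N]^k|+t_X$ for all sufficiently large $N$.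
   Context: $\mathbb{N}=\{1,2,\dots\}$. For $X\subseteq\mathbb{N}^k$ (or $\mathbb{Z}^k$), $FS(X)$ denotes the set of all finite sums of distinct elements of $X$. A set $X$ is called a thin complete set with respect to a region $R\subseteq\mathbb{N}^k$ if $FS(X)\supseteq R$ and $X(N)\leq \log_2 R(N)+t_X$ for some constant $t_X$, where $X(N)$, $R(N)$ denote the number of points of $X$, resp. $R$, in $[1,N]^k$. -}

module Defs where

open import Data.Nat using (ℕ; zero; suc; _^_) renaming (_+_ to _+ℕ_; _*_ to _*ℕ_; _≤_ to _≤ℕ_)
open import Data.Integer using (+_)
open import Data.Rational using (ℚ; 0ℚ; 1ℚ; _+_; _*_; _≤_; _/_)
open import Data.Fin using (Fin; zero; suc; _≟_)
open import Data.Vec using (Vec; []; _∷_; map; zipWith; replicate; lookup)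
open import Data.Vec.Relation.Unary.All as VAll using ()
open import Data.List using (List; []; _∷_; foldr)
open import Data.List.Relation.Unary.All using (All)
open import Data.List.Relation.Unary.Unique.Propositional using (Unique)
open import Data.Product using (Σ; _×_; ∃)
open import Data.Sum using (_⊎_)
open import Relation.Binary.PropositionalEquality using (_≡_; _≢_)
open import Relation.Nullary using (¬_)

Point : ℕ → Set
Point k = Vec ℕ k

ℕtoℚ : ℕ → ℚ
ℕtoℚ n = + n / 1

ΣFin : (k : ℕ) → (Fin k → ℚ) → ℚ
ΣFin zero    f = 0ℚ
ΣFin (suc k) f = f zero + ΣFin k (λ i → f (suc i))

lincomb : {k : ℕ} → (Fin k → ℚ) → (Fin k → Point k) → Fin k → ℚ
lincomb {k} a v j = ΣFin k (λ i → a i * ℕtoℚ (lookup (v i) j))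

-- linear independence (over ℚ; equivalent to over ℝ for integer vectors)
LinIndep : {k : ℕ} → (Fin k → Point k) → Set
LinIndep {k} v = (c : Fin k → ℚ) → (∀ j → lincomb c v j ≡ 0ℚ) → ∀ i → c i ≡ 0ℚ

NotAxisParallel : {k : ℕ} → Point k → Set
NotAxisParallel {k} w = (j : Fin k) → Σ (Fin k) (λ m → m ≢ j × lookup w m ≢ 0)

InCone : {k : ℕ} → (Fin k → Point k) → Point k → Set
InCone {k} v p = Σ (Fin k → ℚ) (λ a → (∀ i → 0ℚ ≤ a i) × (∀ j → lincomb a v j ≡ ℕtoℚ (lookup p j)))

InSimplex : {k : ℕ} → (Fin k → Point k) → Point k → Set
InSimplex {k} v p = Σ (Fin k → ℚ) (λ a → (∀ i → 0ℚ ≤ a i) × (ΣFin k a ≤ 1ℚ)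
  × (∀ j → lincomb a (λ i → map (k *ℕ_) (v i)) j ≡ ℕtoℚ (lookup p j)))

InX : {k : ℕ} → (Fin k → Point k) → Point k → Set
InX {k} v p = InSimplex v p ⊎ Σ (Fin k) (λ i → Σ ℕ (λ j → p ≡ map (2 ^ j *ℕ_) (v i)))

vsum : {k : ℕ} → List (Point k) → Point k
vsum {k} = foldr (zipWith _+ℕ_) (replicate k 0)

InFS : {k : ℕ} → (Point k → Set) → Point k → Set
InFS {k} P p = Σ (List (Point k)) (λ L → ¬ (L ≡ []) × Unique L × All P L × vsum L ≡ p)

InBox : {k : ℕ} → ℕ → Point k → Set
InBox N p = VAll.All (λ x → 1 ≤ℕ x × x ≤ℕ N) p

-- Write p ∈ V as p = Σ a i v i with a i ≥ 0 and split each a i into its integer part m i and its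
-- fractional part f i. Then p = r + Σ m i v i, where r = Σ f i v i = Σ (f i / k)(k v i) is an
-- integer point of the simplex S, and expanding each m i in binary writes Σ m i v i as a sum of
-- distinct points 2^e v i. By linear independence these points are pairwise distinct and differ from
-- r (whose coefficients are < 1), so p ∈ FS(X); conversely X ⊆ V and V is closed under addition.
-- For thinness, points of S have coordinates at most D = k·(sum of the entries of v), and 2^e v i
-- lies in [1,N]^k only if e ≤ ⌊log₂ N⌋, so |X ∩ [1,N]^k| ≤ (D+1)^k + k(⌊log₂ N⌋ + 1). On the other
-- hand, for q = ⌊log₂ N⌋ − D the 2^(qk) combinations Σ c i v i with 1 ≤ c i ≤ 2^q are distinct
-- points of V ∩ [1,N]^k, which yields the bound with t = (D+1)^k + k(D+1) as soon as 2^D ≤ N.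

module Submission where

open import Data.Bool using (Bool; true; false)
open import Data.Empty using (⊥-elim)
open import Data.Fin as Fin using (Fin; zero; suc)
import Data.Fin.Properties as Finₚ
open import Data.List as List using (List; []; _∷_; _++_; length; map)
import Data.List.Properties as Listₚ
open import Data.List.Membership.Propositional using (_∈_)
import Data.List.Membership.Propositional.Properties as ∈ₚ
open import Data.List.Relation.Binary.Subset.Propositional using (_⊆_)
open import Data.List.Relation.Unary.All as All using (All; []; _∷_)
import Data.List.Relation.Unary.All.Properties as Allₚ
open import Data.List.Relation.Unary.AllPairs using ([]; _∷_)
import Data.List.Relation.Unary.AllPairs.Properties as AllPairsₚ
import Data.List.Relation.Unary.Any as Any
open Any using (here; there)
open import Data.List.Relation.Unary.Unique.Propositional using (Unique)
import Data.List.Relation.Unary.Unique.Propositional.Properties as Uniqueₚ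
import Data.Nat as ℕ
open import Data.Nat.Induction using (<-wellFounded)
open import Data.Nat.ListAction using (sum)
open import Data.Nat.Logarithm using (⌊log₂_⌋; ⌊log₂[2^n]⌋≡n; ⌊log₂⌋-mono-≤)
open import Data.Nat.Logarithm.Core using (⌊log2⌋)
import Data.Nat.Properties as ℕₚ
open import Data.Nat.Tactic.RingSolver using (solve-∀)
open import Data.Product using (Σ; ∃; _×_; _,_; proj₁; proj₂)
open import Data.Sum using (_⊎_; inj₁; inj₂)
open import Data.Vec as Vec using (Vec; lookup; tabulate)
import Data.Vec.Properties as Vecₚ
import Data.Vec.Relation.Unary.All.Properties as VAllₚ
open import Defs
open import Function using (_∘_)
open import Induction.WellFounded using (Acc; acc)
open import Relation.Binary.PropositionalEquality
open import Relation.Nullary using (¬_; Dec; yes; no)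

lookup-extensionality : ∀ {A : Set} {k} {x y : Vec A k} → (∀ j → lookup x j ≡ lookup y j) → x ≡ y
lookup-extensionality {x = x} {y} eq =
  trans (sym (Vecₚ.tabulate∘lookup x)) (trans (Vecₚ.tabulate-cong eq) (Vecₚ.tabulate∘lookup y))

infixr 7 _·_
_·_ : ∀ {k} → ℕ.ℕ → Point k → Point k
n · w = Vec.map (n ℕ.*_) w

ΣFinℕ : (k : ℕ.ℕ) → (Fin k → ℕ.ℕ) → ℕ.ℕ
ΣFinℕ ℕ.zero    f = 0
ΣFinℕ (ℕ.suc k) f = f zero ℕ.+ ΣFinℕ k (λ i → f (suc i))

module Coefficients where
  open import Data.Integer as ℤ using (+_; -[1+_])
  import Data.Integer.Properties as ℤₚ
  import Data.Nat.Coprimality as Coprimality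
  open Coprimality using (1-coprimeTo)
  import Data.Nat.DivMod as ℕ
  import Data.Rational as ℚ
  open ℚ using (ℚ; mkℚ; 0ℚ; 1ℚ; _+_; _*_; _-_; -_; _≤_; _<_; _/_; 1/_; *≤*; *<*)
  import Data.Rational.Properties as ℚₚ
  open import Data.Rational.Solver using (module +-*-Solver)
  open +-*-Solver using (solve; _:+_; _:*_; _:-_; _:=_; con)

  ℕtoℚ-mkℚ : ∀ n → ℕtoℚ n ≡ mkℚ (+ n) 0 (Coprimality.sym (1-coprimeTo n))
  ℕtoℚ-mkℚ n = ℚₚ.↥p/↧p≡p (mkℚ (+ n) 0 (Coprimality.sym (1-coprimeTo n)))

  ℕtoℚ-+ : ∀ m n → ℕtoℚ (m ℕ.+ n) ≡ ℕtoℚ m + ℕtoℚ n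
  ℕtoℚ-+ m n = sym (trans (cong₂ _+_ (ℕtoℚ-mkℚ m) (ℕtoℚ-mkℚ n))
    (cong (_/ 1) (cong₂ ℤ._+_ (ℤₚ.*-identityʳ (+ m)) (ℤₚ.*-identityʳ (+ n)))))

  ℕtoℚ-* : ∀ m n → ℕtoℚ (m ℕ.* n) ≡ ℕtoℚ m * ℕtoℚ n
  ℕtoℚ-* m n = sym (trans (cong₂ _*_ (ℕtoℚ-mkℚ m) (ℕtoℚ-mkℚ n)) (cong (_/ 1) (ℤₚ.+◃n≡+n (m ℕ.* n))))

  ℕtoℚ-mono-≤ : ∀ {m n} → m ℕ.≤ n → ℕtoℚ m ≤ ℕtoℚ n
  ℕtoℚ-mono-≤ {m} {n} m≤n rewrite ℕtoℚ-mkℚ m | ℕtoℚ-mkℚ n =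
    *≤* (subst₂ ℤ._≤_ (sym (ℤₚ.*-identityʳ (+ m))) (sym (ℤₚ.*-identityʳ (+ n))) (ℤ.+≤+ m≤n))

  ℕtoℚ-cancel-≤ : ∀ {m n} → ℕtoℚ m ≤ ℕtoℚ n → m ℕ.≤ n
  ℕtoℚ-cancel-≤ {m} {n} m≤n rewrite ℕtoℚ-mkℚ m | ℕtoℚ-mkℚ n with m≤n
  ... | *≤* m*1≤n*1 with subst₂ ℤ._≤_ (ℤₚ.*-identityʳ (+ m)) (ℤₚ.*-identityʳ (+ n)) m*1≤n*1
  ... | ℤ.+≤+ m≤n′ = m≤n′

  ℕtoℚ-injective : ∀ {m n} → ℕtoℚ m ≡ ℕtoℚ n → m ≡ n
  ℕtoℚ-injective eq =
    ℕₚ.≤-antisym (ℕtoℚ-cancel-≤ (ℚₚ.≤-reflexive eq)) (ℕtoℚ-cancel-≤ (ℚₚ.≤-reflexive (sym eq)))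

  ℕtoℚ-nonNeg : ∀ n → 0ℚ ≤ ℕtoℚ n
  ℕtoℚ-nonNeg n = ℕtoℚ-mono-≤ {0} {n} ℕ.z≤n

  ℕtoℚ-∸ : ∀ {m n} → n ℕ.≤ m → ℕtoℚ (m ℕ.∸ n) ≡ ℕtoℚ m - ℕtoℚ n
  ℕtoℚ-∸ {m} {n} n≤m = begin
    ℕtoℚ (m ℕ.∸ n)
      ≡⟨ solve 2 (λ x y → x := (x :+ y) :- y) refl (ℕtoℚ (m ℕ.∸ n)) (ℕtoℚ n) ⟩
    ℕtoℚ (m ℕ.∸ n) + ℕtoℚ n - ℕtoℚ n       ≡⟨ cong (_- ℕtoℚ n) (sym (ℕtoℚ-+ (m ℕ.∸ n) n)) ⟩
    ℕtoℚ (m ℕ.∸ n ℕ.+ n) - ℕtoℚ n          ≡⟨ cong (λ x → ℕtoℚ x - ℕtoℚ n) (ℕₚ.m∸n+n≡m n≤m) ⟩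
    ℕtoℚ m - ℕtoℚ n                        ∎
    where open ≡-Reasoning

  *-nonNeg : ∀ {p q} → 0ℚ ≤ p → 0ℚ ≤ q → 0ℚ ≤ p * q
  *-nonNeg {p} {q} 0≤p 0≤q =
    ℚₚ.nonNegative⁻¹ _ {{ℚₚ.nonNeg*nonNeg⇒nonNeg p {{ℚ.nonNegative 0≤p}} q {{ℚ.nonNegative 0≤q}}}}

  floorℕ : ∀ a → 0ℚ ≤ a → ∃ λ m → ℕtoℚ m ≤ a × a < ℕtoℚ (ℕ.suc m)
  floorℕ (mkℚ -[1+ _ ] _ _) (*≤* ())
  floorℕ a@(mkℚ (+ n) d _) _ = m , m≤a , a<1+m
    where
    m = n ℕ./ ℕ.suc d
    m≤a : ℕtoℚ m ≤ a
    m≤a rewrite ℕtoℚ-mkℚ m = *≤* (subst₂ ℤ._≤_ (ℤₚ.pos-* m (ℕ.suc d)) (sym (ℤₚ.*-identityʳ (+ n)))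
      (ℤ.+≤+ (ℕ.m/n*n≤m n (ℕ.suc d))))
    a<1+m : a < ℕtoℚ (ℕ.suc m)
    a<1+m rewrite ℕtoℚ-mkℚ (ℕ.suc m) =
      *<* (subst₂ ℤ._<_ (sym (ℤₚ.*-identityʳ (+ n))) (ℤₚ.pos-* (ℕ.suc m) (ℕ.suc d))
      (ℤ.+<+ (subst (ℕ._< ℕ.suc m ℕ.* ℕ.suc d) (sym (ℕ.m≡m%n+[m/n]*n n (ℕ.suc d)))
        (ℕₚ.+-monoˡ-< (m ℕ.* ℕ.suc d) (ℕ.m%n<n n (ℕ.suc d))))))

  ΣFin-cong : ∀ k {f g : Fin k → ℚ} → (∀ i → f i ≡ g i) → ΣFin k f ≡ ΣFin k g
  ΣFin-cong ℕ.zero    eq = refl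
  ΣFin-cong (ℕ.suc k) eq = cong₂ _+_ (eq zero) (ΣFin-cong k (λ i → eq (suc i)))

  ΣFin-+ : ∀ k (f g : Fin k → ℚ) → ΣFin k (λ i → f i + g i) ≡ ΣFin k f + ΣFin k g
  ΣFin-+ ℕ.zero    f g = refl
  ΣFin-+ (ℕ.suc k) f g rewrite ΣFin-+ k (λ i → f (suc i)) (λ i → g (suc i)) =
    solve 4 (λ a b c d → (a :+ b) :+ (c :+ d) := (a :+ c) :+ (b :+ d)) refl
      (f zero) (g zero) (ΣFin k (λ i → f (suc i))) (ΣFin k (λ i → g (suc i)))

  ΣFin-*ˡ : ∀ k c (f : Fin k → ℚ) → ΣFin k (λ i → c * f i) ≡ c * ΣFin k f
  ΣFin-*ˡ ℕ.zero    c f = sym (ℚₚ.*-zeroʳ c)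
  ΣFin-*ˡ (ℕ.suc k) c f rewrite ΣFin-*ˡ k c (λ i → f (suc i)) = sym (ℚₚ.*-distribˡ-+ c (f zero) _)

  ΣFin-zero : ∀ k (f : Fin k → ℚ) → (∀ i → f i ≡ 0ℚ) → ΣFin k f ≡ 0ℚ
  ΣFin-zero ℕ.zero    f eq = refl
  ΣFin-zero (ℕ.suc k) f eq rewrite eq zero | ΣFin-zero k (λ i → f (suc i)) (λ i → eq (suc i)) = refl

  ΣFin-δ : ∀ k (f : Fin k → ℚ) i₀ → (∀ i → i ≢ i₀ → f i ≡ 0ℚ) → ΣFin k f ≡ f i₀
  ΣFin-δ (ℕ.suc k) f zero eq
    rewrite ΣFin-zero k (λ i → f (suc i)) (λ i → eq (suc i) λ ()) = ℚₚ.+-identityʳ (f zero)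
  ΣFin-δ (ℕ.suc k) f (suc i₀) eq
    rewrite eq zero (λ ()) | ΣFin-δ k (λ i → f (suc i)) i₀ (λ i i≢i₀ → eq (suc i) (i≢i₀ ∘ Finₚ.suc-injective)) =
    ℚₚ.+-identityˡ (f (suc i₀))

  ΣFin-mono-≤ : ∀ k {f g : Fin k → ℚ} → (∀ i → f i ≤ g i) → ΣFin k f ≤ ΣFin k g
  ΣFin-mono-≤ ℕ.zero    f≤g = ℚₚ.≤-refl
  ΣFin-mono-≤ (ℕ.suc k) f≤g = ℚₚ.+-mono-≤ (f≤g zero) (ΣFin-mono-≤ k (λ i → f≤g (suc i)))

  ΣFin-const : ∀ k c → ΣFin k (λ _ → c) ≡ ℕtoℚ k * c
  ΣFin-const ℕ.zero    c = sym (ℚₚ.*-zeroˡ c)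
  ΣFin-const (ℕ.suc k) c rewrite ΣFin-const k c | ℕtoℚ-+ 1 k =
    solve 2 (λ c x → c :+ x :* c := (con 1ℚ :+ x) :* c) refl c (ℕtoℚ k)

  ℕtoℚ-ΣFinℕ : ∀ k (f : Fin k → ℕ.ℕ) → ℕtoℚ (ΣFinℕ k f) ≡ ΣFin k (λ i → ℕtoℚ (f i))
  ℕtoℚ-ΣFinℕ ℕ.zero    f = refl
  ℕtoℚ-ΣFinℕ (ℕ.suc k) f =
    trans (ℕtoℚ-+ (f zero) _) (cong (_+_ (ℕtoℚ (f zero))) (ℕtoℚ-ΣFinℕ k (λ i → f (suc i))))

  module _ {k} (v : Fin k → Point k) where

    Coordinates : (Fin k → ℚ) → Point k → Set
    Coordinates a p = ∀ j → lincomb a v j ≡ ℕtoℚ (lookup p j)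

    lincomb-+ : ∀ a b j → lincomb (λ i → a i + b i) v j ≡ lincomb a v j + lincomb b v j
    lincomb-+ a b j = trans (ΣFin-cong k (λ i → ℚₚ.*-distribʳ-+ (ℕtoℚ (lookup (v i) j)) (a i) (b i))) (ΣFin-+ k _ _)

    lincomb-- : ∀ a b j → lincomb (λ i → a i - b i) v j ≡ lincomb a v j - lincomb b v j
    lincomb-- a b j = begin
      lincomb (λ i → a i - b i) v j                        ≡⟨ ΣFin-cong k (λ i → distrib (a i) (b i) (x i)) ⟩
      ΣFin k (λ i → a i * x i + - 1ℚ * (b i * x i))        ≡⟨ ΣFin-+ k _ _ ⟩
      lincomb a v j + ΣFin k (λ i → - 1ℚ * (b i * x i))    ≡⟨ cong (_+_ (lincomb a v j)) (ΣFin-*ˡ k (- 1ℚ) _) ⟩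
      lincomb a v j + - 1ℚ * lincomb b v j
        ≡⟨ solve 2 (λ p q → p :+ con (- 1ℚ) :* q := p :- q) refl (lincomb a v j) (lincomb b v j) ⟩
      lincomb a v j - lincomb b v j                        ∎
      where
      open ≡-Reasoning
      x : Fin k → ℚ
      x i = ℕtoℚ (lookup (v i) j)
      distrib : ∀ p q y → (p - q) * y ≡ p * y + - 1ℚ * (q * y)
      distrib = solve 3 (λ p q y → (p :- q) :* y := p :* y :+ con (- 1ℚ) :* (q :* y)) refl

    coordinates-unique : LinIndep v → ∀ {a b p} → Coordinates a p → Coordinates b p → ∀ i → a i ≡ b i
    coordinates-unique independent {a} {b} {p} a↦p b↦p i = begin
      a i                 ≡⟨ solve 2 (λ x y → x := (x :- y) :+ y) refl (a i) (b i) ⟩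
      (a i - b i) + b i   ≡⟨ cong (_+ b i) (independent (λ i → a i - b i) a-b↦0 i) ⟩
      0ℚ + b i            ≡⟨ ℚₚ.+-identityˡ (b i) ⟩
      b i                 ∎
      where
      open ≡-Reasoning
      a-b↦0 : ∀ j → lincomb (λ i → a i - b i) v j ≡ 0ℚ
      a-b↦0 j = trans (lincomb-- a b j) (trans (cong₂ _-_ (a↦p j) (b↦p j)) (ℚₚ.+-inverseʳ (ℕtoℚ (lookup p j))))

    δ : Fin k → ℚ → Fin k → ℚ
    δ i₀ c i with i Fin.≟ i₀
    ... | yes _ = c
    ... | no  _ = 0ℚ

    δ-diagonal : ∀ i₀ c → δ i₀ c i₀ ≡ c
    δ-diagonal i₀ c with i₀ Fin.≟ i₀
    ... | yes _   = refl
    ... | no  i≢i = ⊥-elim (i≢i refl)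

    δ-offDiagonal : ∀ i₀ c {i} → i ≢ i₀ → δ i₀ c i ≡ 0ℚ
    δ-offDiagonal i₀ c {i} i≢i₀ with i Fin.≟ i₀
    ... | yes i≡i₀ = ⊥-elim (i≢i₀ i≡i₀)
    ... | no  _    = refl

    δ-nonNeg : ∀ i₀ {c} → 0ℚ ≤ c → ∀ i → 0ℚ ≤ δ i₀ c i
    δ-nonNeg i₀ 0≤c i with i Fin.≟ i₀
    ... | yes _ = 0≤c
    ... | no  _ = ℚₚ.≤-refl

    δ-coordinates : ∀ i n → Coordinates (δ i (ℕtoℚ n)) (n · v i)
    δ-coordinates i n j = begin
      lincomb (δ i (ℕtoℚ n)) v j             ≡⟨ ΣFin-δ k _ i off-diagonal ⟩
      δ i (ℕtoℚ n) i * ℕtoℚ (lookup (v i) j) ≡⟨ cong (_* _) (δ-diagonal i _) ⟩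
      ℕtoℚ n * ℕtoℚ (lookup (v i) j)         ≡⟨ sym (ℕtoℚ-* n _) ⟩
      ℕtoℚ (n ℕ.* lookup (v i) j)            ≡⟨ cong ℕtoℚ (sym (Vecₚ.lookup-map j _ (v i))) ⟩
      ℕtoℚ (lookup (n · v i) j)              ∎
      where
      open ≡-Reasoning
      off-diagonal : ∀ i′ → i′ ≢ i → δ i (ℕtoℚ n) i′ * ℕtoℚ (lookup (v i′) j) ≡ 0ℚ
      off-diagonal i′ i′≢i = trans (cong (_* _) (δ-offDiagonal i _ i′≢i)) (ℚₚ.*-zeroˡ (ℕtoℚ (lookup (v i′) j)))

    lincomb-· : ∀ n a j → lincomb a (λ i → n · v i) j ≡ lincomb (λ i → ℕtoℚ n * a i) v j
    lincomb-· n a j = ΣFin-cong k λ i → begin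
      a i * ℕtoℚ (lookup (n · v i) j)          ≡⟨ cong (λ x → a i * ℕtoℚ x) (Vecₚ.lookup-map j _ (v i)) ⟩
      a i * ℕtoℚ (n ℕ.* lookup (v i) j)        ≡⟨ cong (a i *_) (ℕtoℚ-* n _) ⟩
      a i * (ℕtoℚ n * ℕtoℚ (lookup (v i) j))
        ≡⟨ solve 3 (λ x m y → x :* (m :* y) := (m :* x) :* y) refl (a i) (ℕtoℚ n) _ ⟩
      ℕtoℚ n * a i * ℕtoℚ (lookup (v i) j)     ∎
      where open ≡-Reasoning

    combine : (Fin k → ℕ.ℕ) → Point k
    combine c = tabulate (λ j → ΣFinℕ k (λ i → c i ℕ.* lookup (v i) j))

    combine-coordinates : ∀ c → Coordinates (λ i → ℕtoℚ (c i)) (combine c)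
    combine-coordinates c j = begin
      lincomb (λ i → ℕtoℚ (c i)) v j                      ≡⟨ ΣFin-cong k (λ i → sym (ℕtoℚ-* (c i) _)) ⟩
      ΣFin k (λ i → ℕtoℚ (c i ℕ.* lookup (v i) j))        ≡⟨ sym (ℕtoℚ-ΣFinℕ k _) ⟩
      ℕtoℚ (ΣFinℕ k (λ i → c i ℕ.* lookup (v i) j))       ≡⟨ cong ℕtoℚ (sym (Vecₚ.lookup∘tabulate _ j)) ⟩
      ℕtoℚ (lookup (combine c) j)                         ∎
      where open ≡-Reasoning

    combine-injective : LinIndep v → ∀ {c c′} → combine c ≡ combine c′ → ∀ i → c i ≡ c′ i
    combine-injective independent {c} {c′} eq i = ℕtoℚ-injective {c i} {c′ i}
      (coordinates-unique independent {λ i → ℕtoℚ (c i)} {λ i → ℕtoℚ (c′ i)} {combine c}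
        (combine-coordinates c)
        (subst (Coordinates (λ i → ℕtoℚ (c′ i))) (sym eq) (combine-coordinates c′)) i)

    cone-zero : InCone v (Vec.replicate k 0)
    cone-zero = (λ _ → 0ℚ) , (λ _ → ℚₚ.≤-refl) , λ j →
      trans (ΣFin-zero k _ (λ i → ℚₚ.*-zeroˡ (ℕtoℚ (lookup (v i) j)))) (cong ℕtoℚ (sym (Vecₚ.lookup-replicate j 0)))

    cone-+ : ∀ {p q} → InCone v p → InCone v q → InCone v (Vec.zipWith ℕ._+_ p q)
    cone-+ {p} {q} (a , 0≤a , a↦p) (b , 0≤b , b↦q) = (λ i → a i + b i) , 0≤a+b , a+b↦p+q
      where
      0≤a+b : ∀ i → 0ℚ ≤ a i + b i
      0≤a+b i = ℚₚ.+-mono-≤ (0≤a i) (0≤b i)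
      a+b↦p+q : Coordinates (λ i → a i + b i) (Vec.zipWith ℕ._+_ p q)
      a+b↦p+q j = begin
        lincomb (λ i → a i + b i) v j            ≡⟨ lincomb-+ a b j ⟩
        lincomb a v j + lincomb b v j            ≡⟨ cong₂ _+_ (a↦p j) (b↦q j) ⟩
        ℕtoℚ (lookup p j) + ℕtoℚ (lookup q j)    ≡⟨ sym (ℕtoℚ-+ (lookup p j) _) ⟩
        ℕtoℚ (lookup p j ℕ.+ lookup q j)         ≡⟨ cong ℕtoℚ (sym (Vecₚ.lookup-zipWith ℕ._+_ j p q)) ⟩
        ℕtoℚ (lookup (Vec.zipWith ℕ._+_ p q) j)  ∎
        where open ≡-Reasoning

    scaled∈cone : ∀ i n → InCone v (n · v i)
    scaled∈cone i n = δ i (ℕtoℚ n) , δ-nonNeg i (ℕtoℚ-nonNeg n) , δ-coordinates i n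

    simplex⊆cone : ∀ {p} → InSimplex v p → InCone v p
    simplex⊆cone {p} (a , 0≤a , _ , a↦p) =
      (λ i → ℕtoℚ k * a i) , (λ i → *-nonNeg (ℕtoℚ-nonNeg k) (0≤a i)) ,
      λ j → trans (sym (lincomb-· k a j)) (a↦p j)

    X⊆cone : ∀ {p} → InX v p → InCone v p
    X⊆cone {p} (inj₁ p∈S)         = simplex⊆cone {p} p∈S
    X⊆cone (inj₂ (i , e , refl))   = scaled∈cone i (2 ℕ.^ e)

    simplex-bounded : ∀ {b} → (∀ i j → lookup (v i) j ℕ.≤ b)
      → ∀ {x} → InSimplex v x → ∀ j → lookup x j ℕ.≤ k ℕ.* b
    simplex-bounded {b} v≤b {x} (a , 0≤a , Σa≤1 , a↦x) j = ℕtoℚ-cancel-≤ {lookup x j} {k ℕ.* b} (begin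
      ℕtoℚ (lookup x j)                      ≡⟨ sym (a↦x j) ⟩
      lincomb a (λ i → k · v i) j
        ≤⟨ ΣFin-mono-≤ k (λ i → ℚₚ.*-monoˡ-≤-nonNeg (a i) {{ℚ.nonNegative (0≤a i)}} (entry≤kb i)) ⟩
      ΣFin k (λ i → a i * ℕtoℚ (k ℕ.* b))    ≡⟨ ΣFin-cong k (λ i → ℚₚ.*-comm (a i) _) ⟩
      ΣFin k (λ i → ℕtoℚ (k ℕ.* b) * a i)    ≡⟨ ΣFin-*ˡ k (ℕtoℚ (k ℕ.* b)) a ⟩
      ℕtoℚ (k ℕ.* b) * ΣFin k a
        ≤⟨ ℚₚ.*-monoˡ-≤-nonNeg (ℕtoℚ (k ℕ.* b)) {{ℚ.nonNegative (ℕtoℚ-nonNeg (k ℕ.* b))}} Σa≤1 ⟩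
      ℕtoℚ (k ℕ.* b) * 1ℚ                    ≡⟨ ℚₚ.*-identityʳ _ ⟩
      ℕtoℚ (k ℕ.* b)                         ∎)
      where
      open ℚₚ.≤-Reasoning
      entry≤kb : ∀ i → ℕtoℚ (lookup (k · v i) j) ≤ ℕtoℚ (k ℕ.* b)
      entry≤kb i =
        ℕtoℚ-mono-≤ (subst (ℕ._≤ k ℕ.* b) (sym (Vecₚ.lookup-map j _ (v i))) (ℕₚ.*-monoʳ-≤ k (v≤b i j)))

    X-zero-column : ∀ {j} → (∀ i → lookup (v i) j ≡ 0) → ∀ {x} → InX v x → lookup x j ≡ 0
    X-zero-column {j} vᵢⱼ≡0 {x} (inj₁ (a , _ , _ , a↦x)) = ℕtoℚ-injective {lookup x j} {0} (begin
      ℕtoℚ (lookup x j)                                   ≡⟨ sym (a↦x j) ⟩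
      lincomb a (λ i → k · v i) j
        ≡⟨ ΣFin-zero k _ (λ i → trans (cong (λ y → a i * ℕtoℚ y) (kvᵢⱼ≡0 i)) (ℚₚ.*-zeroʳ (a i))) ⟩
      0ℚ                                                  ∎)
      where
      open ≡-Reasoning
      kvᵢⱼ≡0 : ∀ i → lookup (k · v i) j ≡ 0
      kvᵢⱼ≡0 i = trans (Vecₚ.lookup-map j _ (v i)) (trans (cong (k ℕ.*_) (vᵢⱼ≡0 i)) (ℕₚ.*-zeroʳ k))
    X-zero-column {j} vᵢⱼ≡0 (inj₂ (i , e , refl)) =
      trans (Vecₚ.lookup-map j _ (v i)) (trans (cong (2 ℕ.^ e ℕ.*_) (vᵢⱼ≡0 i)) (ℕₚ.*-zeroʳ (2 ℕ.^ e)))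

  fractional⇒simplex : ∀ k (v : Fin k → Point k) {f r} → (∀ i → 0ℚ ≤ f i) → (∀ i → f i ≤ 1ℚ)
    → Coordinates v f r → InSimplex v r
  fractional⇒simplex ℕ.zero    v _ _ _ = (λ ()) , (λ ()) , *≤* (ℤ.+≤+ ℕ.z≤n) , λ ()
  fractional⇒simplex (ℕ.suc k) v {f} {r} 0≤f f≤1 f↦r = g , 0≤g , Σg≤1 , g↦r
    where
    -- ℕtoℚ (suc k) in constructor form, so that 1/_ finds its NonZero instance.
    K = mkℚ (+ ℕ.suc k) 0 (Coprimality.sym (1-coprimeTo (ℕ.suc k)))
    K⁻¹ = 1/ K
    0≤K⁻¹ : 0ℚ ≤ K⁻¹
    0≤K⁻¹ = *≤* (ℤ.+≤+ ℕ.z≤n)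
    K*K⁻¹≡1 : ℕtoℚ (ℕ.suc k) * K⁻¹ ≡ 1ℚ
    K*K⁻¹≡1 = trans (cong (_* K⁻¹) (ℕtoℚ-mkℚ (ℕ.suc k))) (ℚₚ.*-inverseʳ K)
    g : Fin (ℕ.suc k) → ℚ
    g i = f i * K⁻¹
    0≤g : ∀ i → 0ℚ ≤ g i
    0≤g i = *-nonNeg (0≤f i) 0≤K⁻¹
    Σg≤1 : ΣFin (ℕ.suc k) g ≤ 1ℚ
    Σg≤1 = begin
      ΣFin (ℕ.suc k) g
        ≤⟨ ΣFin-mono-≤ (ℕ.suc k) (λ i → ℚₚ.*-monoʳ-≤-nonNeg K⁻¹ {{ℚ.nonNegative 0≤K⁻¹}} (f≤1 i)) ⟩
      ΣFin (ℕ.suc k) (λ _ → 1ℚ * K⁻¹) ≡⟨ ΣFin-const (ℕ.suc k) _ ⟩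
      ℕtoℚ (ℕ.suc k) * (1ℚ * K⁻¹)   ≡⟨ cong (ℕtoℚ (ℕ.suc k) *_) (ℚₚ.*-identityˡ K⁻¹) ⟩
      ℕtoℚ (ℕ.suc k) * K⁻¹          ≡⟨ K*K⁻¹≡1 ⟩
      1ℚ                            ∎
      where open ℚₚ.≤-Reasoning
    g↦r : ∀ j → lincomb g (λ i → ℕ.suc k · v i) j ≡ ℕtoℚ (lookup r j)
    g↦r j = trans (lincomb-· v (ℕ.suc k) g j)
      (trans (ΣFin-cong (ℕ.suc k) (λ i → cong (_* ℕtoℚ (lookup (v i) j)) (K*g≡f i))) (f↦r j))
      where
      K*g≡f : ∀ i → ℕtoℚ (ℕ.suc k) * g i ≡ f i
      K*g≡f i = begin
        ℕtoℚ (ℕ.suc k) * (f i * K⁻¹)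
          ≡⟨ solve 3 (λ x y z → x :* (y :* z) := y :* (x :* z)) refl (ℕtoℚ (ℕ.suc k)) (f i) K⁻¹ ⟩
        f i * (ℕtoℚ (ℕ.suc k) * K⁻¹)   ≡⟨ cong (f i *_) K*K⁻¹≡1 ⟩
        f i * 1ℚ                       ≡⟨ ℚₚ.*-identityʳ (f i) ⟩
        f i                            ∎
        where open ≡-Reasoning

  module _ {k} (v : Fin k → Point k) (independent : LinIndep v) where

    scaled-injective : ∀ {i i′ n n′} → 1 ℕ.≤ n → n · v i ≡ n′ · v i′ → i ≡ i′ × n ≡ n′
    scaled-injective {i} {i′} {n} {n′} 1≤n eq = compare (i Fin.≟ i′) δ-at-i
      where
      δ-at-i : δ v i (ℕtoℚ n) i ≡ δ v i′ (ℕtoℚ n′) i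
      δ-at-i = coordinates-unique v independent {δ v i (ℕtoℚ n)} {δ v i′ (ℕtoℚ n′)} {n · v i} (δ-coordinates v i n)
        (subst (Coordinates v (δ v i′ (ℕtoℚ n′))) (sym eq) (δ-coordinates v i′ n′)) i
      compare : Dec (i ≡ i′) → δ v i (ℕtoℚ n) i ≡ δ v i′ (ℕtoℚ n′) i → i ≡ i′ × n ≡ n′
      compare (yes refl) δ≡δ =
        refl , ℕtoℚ-injective {n} {n′} (trans (sym (δ-diagonal v i _)) (trans δ≡δ (δ-diagonal v i _)))
      compare (no i≢i′) δ≡δ = ⊥-elim (ℕₚ.<⇒≢ 1≤n (sym (ℕtoℚ-injective {n} {0}
        (trans (sym (δ-diagonal v i _)) (trans δ≡δ (δ-offDiagonal v i′ _ i≢i′))))))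

    fractional-not-scaled : ∀ {f r} → (∀ i → f i < 1ℚ) → Coordinates v f r → ∀ i {n} → 1 ℕ.≤ n → r ≢ n · v i
    fractional-not-scaled {f} {r} f<1 f↦r i {n} 1≤n r≡nvᵢ = ℚₚ.<-irrefl refl (ℚₚ.<-≤-trans (f<1 i) 1≤fᵢ)
      where
      fᵢ≡n : f i ≡ ℕtoℚ n
      fᵢ≡n = trans (coordinates-unique v independent {f} {δ v i (ℕtoℚ n)} {r} f↦r
        (subst (Coordinates v (δ v i (ℕtoℚ n))) (sym r≡nvᵢ) (δ-coordinates v i n)) i) (δ-diagonal v i _)
      1≤fᵢ : 1ℚ ≤ f i
      1≤fᵢ = subst (1ℚ ≤_) (sym fᵢ≡n) (ℕtoℚ-mono-≤ {1} {n} 1≤n)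

    record Decomposition (p : Point k) : Set where
      field
        whole            : Fin k → ℕ.ℕ
        remainder        : Point k
        remainder∈S      : InSimplex v remainder
        remainder∉powers : ∀ i e → remainder ≢ 2 ℕ.^ e · v i
        sum≡             : Vec.zipWith ℕ._+_ remainder (combine v whole) ≡ p

    decompose : ∀ {p} → InCone v p → Decomposition p
    decompose {p} (a , 0≤a , a↦p) = record
      { whole            = m
      ; remainder        = r
      ; remainder∈S      = fractional⇒simplex k v {f} {r} 0≤f (λ i → ℚₚ.<⇒≤ (f<1 i)) f↦r
      ; remainder∉powers = λ i e → fractional-not-scaled {f} {r} f<1 f↦r i (ℕₚ.m^n>0 2 e)
      ; sum≡             = lookup-extensionality λ j → begin
          lookup (Vec.zipWith ℕ._+_ r s) j          ≡⟨ Vecₚ.lookup-zipWith ℕ._+_ j r s ⟩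
          lookup r j ℕ.+ lookup s j                 ≡⟨ cong (ℕ._+ lookup s j) (Vecₚ.lookup∘tabulate _ j) ⟩
          lookup p j ℕ.∸ lookup s j ℕ.+ lookup s j  ≡⟨ ℕₚ.m∸n+n≡m (s≤p j) ⟩
          lookup p j                                ∎
      }
      where
      open ≡-Reasoning
      m : Fin k → ℕ.ℕ
      m i = proj₁ (floorℕ (a i) (0≤a i))
      m≤a : ∀ i → ℕtoℚ (m i) ≤ a i
      m≤a i = proj₁ (proj₂ (floorℕ (a i) (0≤a i)))
      a<1+m : ∀ i → a i < ℕtoℚ (ℕ.suc (m i))
      a<1+m i = proj₂ (proj₂ (floorℕ (a i) (0≤a i)))
      f : Fin k → ℚ
      f i = a i - ℕtoℚ (m i)
      0≤f : ∀ i → 0ℚ ≤ f i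
      0≤f i = subst (_≤ f i) (ℚₚ.+-inverseʳ (ℕtoℚ (m i))) (ℚₚ.+-monoˡ-≤ (- ℕtoℚ (m i)) (m≤a i))
      f<1 : ∀ i → f i < 1ℚ
      f<1 i = subst (f i <_) (trans (cong (_- ℕtoℚ (m i)) (ℕtoℚ-+ 1 (m i)))
          (solve 1 (λ x → (con 1ℚ :+ x) :- x := con 1ℚ) refl (ℕtoℚ (m i))))
        (ℚₚ.+-monoˡ-< (- ℕtoℚ (m i)) (a<1+m i))
      s : Point k
      s = combine v m
      s≤p : ∀ j → lookup s j ℕ.≤ lookup p j
      s≤p j = ℕtoℚ-cancel-≤ {lookup s j} {lookup p j} (subst₂ _≤_ (combine-coordinates v m j) (a↦p j)
        (ΣFin-mono-≤ k λ i → ℚₚ.*-monoʳ-≤-nonNeg _ {{ℚ.nonNegative (ℕtoℚ-nonNeg (lookup (v i) j))}} (m≤a i)))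
      r : Point k
      r = tabulate (λ j → lookup p j ℕ.∸ lookup s j)
      f↦r : Coordinates v f r
      f↦r j = begin
        lincomb f v j                                  ≡⟨ lincomb-- v a (λ i → ℕtoℚ (m i)) j ⟩
        lincomb a v j - lincomb (λ i → ℕtoℚ (m i)) v j ≡⟨ cong₂ _-_ (a↦p j) (combine-coordinates v m j) ⟩
        ℕtoℚ (lookup p j) - ℕtoℚ (lookup s j)          ≡⟨ sym (ℕtoℚ-∸ (s≤p j)) ⟩
        ℕtoℚ (lookup p j ℕ.∸ lookup s j)               ≡⟨ cong ℕtoℚ (sym (Vecₚ.lookup∘tabulate _ j)) ⟩
        ℕtoℚ (lookup r j)                              ∎

-- The operators of ℕ are opened only now: inside Coefficients the same names denote those of ℚ.
open Coefficients
open import Data.Nat using (ℕ; zero; suc; _+_; _*_; _∸_; _^_; _≤_; _<_; z≤n; s≤s; ⌊_/2⌋; ⌈_/2⌉)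

ΣFinℕ-cong : ∀ k {f g : Fin k → ℕ} → (∀ i → f i ≡ g i) → ΣFinℕ k f ≡ ΣFinℕ k g
ΣFinℕ-cong zero    eq = refl
ΣFinℕ-cong (suc k) eq = cong₂ _+_ (eq zero) (ΣFinℕ-cong k (λ i → eq (suc i)))

ΣFinℕ-≥ : ∀ k (f : Fin k → ℕ) i → f i ≤ ΣFinℕ k f
ΣFinℕ-≥ (suc k) f zero    = ℕₚ.m≤m+n _ _
ΣFinℕ-≥ (suc k) f (suc i) = ℕₚ.≤-trans (ΣFinℕ-≥ k (λ i → f (suc i)) i) (ℕₚ.m≤n+m _ (f zero))

ΣFinℕ-mono-≤ : ∀ k {f g : Fin k → ℕ} → (∀ i → f i ≤ g i) → ΣFinℕ k f ≤ ΣFinℕ k g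
ΣFinℕ-mono-≤ zero    f≤g = z≤n
ΣFinℕ-mono-≤ (suc k) f≤g = ℕₚ.+-mono-≤ (f≤g zero) (ΣFinℕ-mono-≤ k (λ i → f≤g (suc i)))

ΣFinℕ-const : ∀ k c → ΣFinℕ k (λ _ → c) ≡ k * c
ΣFinℕ-const zero    c = refl
ΣFinℕ-const (suc k) c = cong (_+_ c) (ΣFinℕ-const k c)

-- Binary digits are listed least significant first.
incr : List Bool → List Bool
incr []           = true ∷ []
incr (false ∷ bs) = true ∷ bs
incr (true ∷ bs)  = false ∷ incr bs

toBits : ℕ → List Bool
toBits zero    = []
toBits (suc n) = incr (toBits n)

fromBits : List Bool → ℕ
fromBits []           = 0
fromBits (false ∷ bs) = 2 * fromBits bs
fromBits (true ∷ bs)  = 1 + 2 * fromBits bs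

fromBits-incr : ∀ bs → fromBits (incr bs) ≡ suc (fromBits bs)
fromBits-incr []           = refl
fromBits-incr (false ∷ bs) = refl
fromBits-incr (true ∷ bs)  rewrite fromBits-incr bs = cong suc (ℕₚ.+-suc (fromBits bs) (fromBits bs + 0))

fromBits-toBits : ∀ n → fromBits (toBits n) ≡ n
fromBits-toBits zero    = refl
fromBits-toBits (suc n) = trans (fromBits-incr (toBits n)) (cong suc (fromBits-toBits n))

onesFrom : ℕ → List Bool → List ℕ
onesFrom e []           = []
onesFrom e (false ∷ bs) = onesFrom (suc e) bs
onesFrom e (true ∷ bs)  = e ∷ onesFrom (suc e) bs

sum-powers-onesFrom : ∀ e bs → sum (map (2 ^_) (onesFrom e bs)) ≡ 2 ^ e * fromBits bs
sum-powers-onesFrom e []           = sym (ℕₚ.*-zeroʳ (2 ^ e))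
sum-powers-onesFrom e (false ∷ bs) rewrite sum-powers-onesFrom (suc e) bs = shift (2 ^ e) (fromBits bs)
  where
  shift : ∀ x y → 2 * x * y ≡ x * (2 * y)
  shift = solve-∀
sum-powers-onesFrom e (true ∷ bs)  rewrite sum-powers-onesFrom (suc e) bs = shift (2 ^ e) (fromBits bs)
  where
  shift : ∀ x y → x + 2 * x * y ≡ x * (1 + 2 * y)
  shift = solve-∀

onesFrom-≥ : ∀ e bs → All (e ≤_) (onesFrom e bs)
onesFrom-≥ e []           = []
onesFrom-≥ e (false ∷ bs) = All.map (ℕₚ.<⇒≤) (onesFrom-≥ (suc e) bs)
onesFrom-≥ e (true ∷ bs)  = ℕₚ.≤-refl ∷ All.map (ℕₚ.<⇒≤) (onesFrom-≥ (suc e) bs)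

onesFrom-unique : ∀ e bs → Unique (onesFrom e bs)
onesFrom-unique e []           = []
onesFrom-unique e (false ∷ bs) = onesFrom-unique (suc e) bs
onesFrom-unique e (true ∷ bs)  = All.map ℕₚ.<⇒≢ (onesFrom-≥ (suc e) bs) ∷ onesFrom-unique (suc e) bs

binaryExponents : ℕ → List ℕ
binaryExponents n = onesFrom 0 (toBits n)

sum-powers-binaryExponents : ∀ n → sum (map (2 ^_) (binaryExponents n)) ≡ n
sum-powers-binaryExponents n =
  trans (sum-powers-onesFrom 0 (toBits n)) (trans (ℕₚ.+-identityʳ _) (fromBits-toBits n))

2^-injective : ∀ {m n} → 2 ^ m ≡ 2 ^ n → m ≡ n
2^-injective {m} {n} eq = trans (sym (⌊log₂[2^n]⌋≡n m)) (trans (cong ⌊log₂_⌋ eq) (⌊log₂[2^n]⌋≡n n))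

-- ⌊log₂ n ⌋ unfolds to ⌊log2⌋ n (<-wellFounded n), so the induction follows the recursion of ⌊log2⌋.
2^⌊log2⌋≤n : ∀ n (acc : Acc _<_ n) → 1 ≤ n → 2 ^ ⌊log2⌋ n acc ≤ n
2^⌊log2⌋≤n 1             _        _ = ℕₚ.≤-refl
2^⌊log2⌋≤n (suc (suc n)) (acc rs) _ = begin
  2 * 2 ^ ⌊log2⌋ (suc ⌊ n /2⌋) _  ≤⟨ ℕₚ.*-monoʳ-≤ 2 (2^⌊log2⌋≤n (suc ⌊ n /2⌋) _ (s≤s z≤n)) ⟩
  2 * suc ⌊ n /2⌋                ≡⟨ double-suc ⌊ n /2⌋ ⟩
  2 + (⌊ n /2⌋ + ⌊ n /2⌋)        ≤⟨ ℕₚ.+-monoʳ-≤ 2 (ℕₚ.+-monoʳ-≤ ⌊ n /2⌋ (ℕₚ.⌊n/2⌋≤⌈n/2⌉ n)) ⟩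
  2 + (⌊ n /2⌋ + ⌈ n /2⌉)        ≡⟨ cong (_+_ 2) (ℕₚ.⌊n/2⌋+⌈n/2⌉≡n n) ⟩
  2 + n                          ∎
  where
  open ℕₚ.≤-Reasoning
  double-suc : ∀ h → 2 * suc h ≡ 2 + (h + h)
  double-suc = solve-∀

2^⌊log₂n⌋≤n : ∀ n → 1 ≤ n → 2 ^ ⌊log₂ n ⌋ ≤ n
2^⌊log₂n⌋≤n n = 2^⌊log2⌋≤n n (<-wellFounded n)

2^e≤n⇒e≤⌊log₂n⌋ : ∀ {e n} → 2 ^ e ≤ n → e ≤ ⌊log₂ n ⌋
2^e≤n⇒e≤⌊log₂n⌋ {e} 2^e≤n = subst (_≤ _) (⌊log₂[2^n]⌋≡n e) (⌊log₂⌋-mono-≤ 2^e≤n)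

n<2^n : ∀ n → n < 2 ^ n
n<2^n zero    = s≤s z≤n
n<2^n (suc n) = subst (_≤ 2 ^ suc n) (ℕₚ.+-comm (suc n) 1)
  (ℕₚ.+-mono-≤ (n<2^n n) (ℕₚ.≤-trans (ℕₚ.m^n>0 2 n) (ℕₚ.m≤m+n (2 ^ n) 0)))

vsum-map-· : ∀ {k} ns (w : Point k) → vsum (map (_· w) ns) ≡ sum ns · w
vsum-map-· [] w = lookup-extensionality λ j →
  trans (Vecₚ.lookup-replicate j 0) (sym (Vecₚ.lookup-map j _ w))
vsum-map-· (n ∷ ns) w = lookup-extensionality λ j → begin
  lookup (vsum (map (_· w) (n ∷ ns))) j              ≡⟨ Vecₚ.lookup-zipWith _+_ j (n · w) _ ⟩
  lookup (n · w) j + lookup (vsum (map (_· w) ns)) j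
    ≡⟨ cong₂ _+_ (Vecₚ.lookup-map j _ w) (cong (λ x → lookup x j) (vsum-map-· ns w)) ⟩
  n * lookup w j + lookup (sum ns · w) j              ≡⟨ cong (_+_ (n * lookup w j)) (Vecₚ.lookup-map j _ w) ⟩
  n * lookup w j + sum ns * lookup w j                ≡⟨ sym (ℕₚ.*-distribʳ-+ (lookup w j) n (sum ns)) ⟩
  (n + sum ns) * lookup w j                           ≡⟨ sym (Vecₚ.lookup-map j _ w) ⟩
  lookup ((n + sum ns) · w) j                         ∎
  where open ≡-Reasoning

lookup-vsum-++ : ∀ {k} (ps qs : List (Point k)) j →
  lookup (vsum (ps ++ qs)) j ≡ lookup (vsum ps) j + lookup (vsum qs) j
lookup-vsum-++ [] qs j = cong (_+ lookup (vsum qs) j) (sym (Vecₚ.lookup-replicate j 0))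
lookup-vsum-++ (p ∷ ps) qs j = begin
  lookup (vsum (p ∷ ps ++ qs)) j                          ≡⟨ Vecₚ.lookup-zipWith _+_ j p _ ⟩
  lookup p j + lookup (vsum (ps ++ qs)) j                 ≡⟨ cong (_+_ (lookup p j)) (lookup-vsum-++ ps qs j) ⟩
  lookup p j + (lookup (vsum ps) j + lookup (vsum qs) j)  ≡⟨ sym (ℕₚ.+-assoc (lookup p j) _ _) ⟩
  lookup p j + lookup (vsum ps) j + lookup (vsum qs) j
    ≡⟨ cong (_+ lookup (vsum qs) j) (sym (Vecₚ.lookup-zipWith _+_ j p _)) ⟩
  lookup (vsum (p ∷ ps)) j + lookup (vsum qs) j           ∎
  where open ≡-Reasoning

lookup-vsum-concat-tabulate : ∀ {k} m (B : Fin m → List (Point k)) j →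
  lookup (vsum (List.concat (List.tabulate B))) j ≡ ΣFinℕ m (λ i → lookup (vsum (B i)) j)
lookup-vsum-concat-tabulate zero    B j = Vecₚ.lookup-replicate j 0
lookup-vsum-concat-tabulate (suc m) B j = trans (lookup-vsum-++ (B zero) _ j)
  (cong (_+_ (lookup (vsum (B zero)) j)) (lookup-vsum-concat-tabulate m (λ i → B (suc i)) j))

∈-concat-tabulate⁻ : ∀ {A : Set} {m} (B : Fin m → List A) {x}
  → x ∈ List.concat (List.tabulate B) → ∃ λ i → x ∈ B i
∈-concat-tabulate⁻ B x∈
  with xs , x∈xs , xs∈ ← ∈ₚ.∈-concat⁻′ (List.tabulate B) x∈
  with i , refl ← ∈ₚ.∈-tabulate⁻ xs∈ = i , x∈xs

concat-tabulate-unique : ∀ {A : Set} {m} (B : Fin m → List A) → (∀ i → Unique (B i))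
  → (∀ {i i′ x} → x ∈ B i → x ∈ B i′ → i ≡ i′) → Unique (List.concat (List.tabulate B))
concat-tabulate-unique B unique disjoint =
  Uniqueₚ.concat⁺ (Allₚ.tabulate⁺ unique)
    (AllPairsₚ.tabulate⁺ λ i≢i′ (x∈Bi , x∈Bi′) → i≢i′ (disjoint x∈Bi x∈Bi′))

∈-removeAt : ∀ {A : Set} {x z : A} {ys} (x∈ys : x ∈ ys) → z ∈ ys → x ≢ z → z ∈ List.removeAt ys (Any.index x∈ys)
∈-removeAt (here refl) (here refl) x≢z = ⊥-elim (x≢z refl)
∈-removeAt (here _)    (there z∈)  _   = z∈
∈-removeAt (there _)   (here z≡)   _   = here z≡
∈-removeAt (there x∈)  (there z∈)  x≢z = there (∈-removeAt x∈ z∈ x≢z)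

unique-⊆⇒length-≤ : ∀ {A : Set} {xs ys : List A} → Unique xs → xs ⊆ ys → length xs ≤ length ys
unique-⊆⇒length-≤ {xs = []}     _             _     = z≤n
unique-⊆⇒length-≤ {xs = x ∷ xs} {ys} (x∉xs ∷ xs!) xs⊆ys = begin
  suc (length xs)                           ≤⟨ s≤s (unique-⊆⇒length-≤ xs! xs⊆ys-x) ⟩
  suc (length (List.removeAt ys (Any.index x∈ys))) ≡⟨ sym (Listₚ.length-removeAt′ ys _) ⟩
  length ys                                 ∎
  where
  open ℕₚ.≤-Reasoning
  x∈ys = xs⊆ys (here refl)
  xs⊆ys-x : xs ⊆ List.removeAt ys (Any.index x∈ys)
  xs⊆ys-x z∈xs = ∈-removeAt x∈ys (xs⊆ys (there z∈xs)) (All.lookup x∉xs z∈xs)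

length-cartesianProductWith : ∀ {A B C : Set} (f : A → B → C) xs ys →
  length (List.cartesianProductWith f xs ys) ≡ length xs * length ys
length-cartesianProductWith f []       ys = refl
length-cartesianProductWith f (x ∷ xs) ys = trans (Listₚ.length-++ (map (f x) ys))
  (cong₂ _+_ (Listₚ.length-map (f x) ys) (length-cartesianProductWith f xs ys))

cube : List ℕ → (k : ℕ) → List (Vec ℕ k)
cube xs zero    = Vec.[] ∷ []
cube xs (suc k) = List.cartesianProductWith Vec._∷_ xs (cube xs k)

length-cube : ∀ xs k → length (cube xs k) ≡ length xs ^ k
length-cube xs zero    = refl
length-cube xs (suc k) = trans (length-cartesianProductWith Vec._∷_ xs (cube xs k)) (cong (length xs *_) (length-cube xs k))

cube-unique : ∀ {xs} → Unique xs → ∀ k → Unique (cube xs k)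
cube-unique xs! zero    = [] ∷ []
cube-unique xs! (suc k) = Uniqueₚ.cartesianProductWith⁺ Vec._∷_ Vecₚ.∷-injective xs! (cube-unique xs! k)

∈-cube⁺ : ∀ xs {k} (x : Vec ℕ k) → (∀ j → lookup x j ∈ xs) → x ∈ cube xs k
∈-cube⁺ xs Vec.[]       _   = here refl
∈-cube⁺ xs (x Vec.∷ x′) x∈ = ∈ₚ.∈-cartesianProductWith⁺ Vec._∷_ (x∈ zero) (∈-cube⁺ xs x′ (x∈ ∘ suc))

∈-cube⁻ : ∀ xs {k} {x : Vec ℕ k} → x ∈ cube xs k → ∀ j → lookup x j ∈ xs
∈-cube⁻ xs {suc k} x∈ j
  with a , x′ , a∈ , x′∈ , refl ← ∈ₚ.∈-cartesianProductWith⁻ Vec._∷_ xs (cube xs k) x∈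
  with j
... | zero  = a∈
... | suc j = ∈-cube⁻ xs x′∈ j

vsum-cone : ∀ {k} (v : Fin k → Point k) {ps} → All (InCone v) ps → InCone v (vsum ps)
vsum-cone v {[]}     []           = cone-zero v
vsum-cone v {p ∷ ps} (p∈U ∷ ps∈U) = cone-+ v {p} {vsum ps} p∈U (vsum-cone v ps∈U)

FS⊆cone : ∀ {k} (v : Fin k → Point k) {p} → InFS (InX v) p → InCone v p
FS⊆cone v (ps , _ , _ , ps⊆X , refl) = vsum-cone v {ps} (All.map (λ {x} → X⊆cone v {x}) ps⊆X)

module _ {k} (v : Fin k → Point k) (independent : LinIndep v) where

  powers : Fin k → List ℕ → List (Point k)
  powers i = map (λ e → 2 ^ e · v i)

  ∈-powers⁻ : ∀ {i es x} → x ∈ powers i es → ∃ λ e → x ≡ 2 ^ e · v i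
  ∈-powers⁻ x∈ with e , _ , x≡ ← ∈ₚ.∈-map⁻ _ x∈ = e , x≡

  powers-injective : ∀ {i i′ e e′} → 2 ^ e · v i ≡ 2 ^ e′ · v i′ → i ≡ i′ × e ≡ e′
  powers-injective {i} {i′} {e} {e′} eq =
    let (i≡i′ , 2^e≡2^e′) = scaled-injective v independent {i} {i′} {2 ^ e} {2 ^ e′} (ℕₚ.m^n>0 2 e) eq
    in i≡i′ , 2^-injective {e} {e′} 2^e≡2^e′

  binaryParts : (Fin k → ℕ) → List (Point k)
  binaryParts m = List.concat (List.tabulate λ i → powers i (binaryExponents (m i)))

  ∈-binaryParts⁻ : ∀ m {x} → x ∈ binaryParts m → ∃ λ i → ∃ λ e → x ≡ 2 ^ e · v i
  ∈-binaryParts⁻ m x∈ with i , x∈Bi ← ∈-concat-tabulate⁻ _ x∈ = i , ∈-powers⁻ x∈Bi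

  binaryParts-unique : ∀ m → Unique (binaryParts m)
  binaryParts-unique m = concat-tabulate-unique _
    (λ i → Uniqueₚ.map⁺ (proj₂ ∘ powers-injective) (onesFrom-unique 0 (toBits (m i))))
    λ {i} {i′} x∈Bi x∈Bi′ → let (e , x≡) = ∈-powers⁻ x∈Bi ; (e′ , x≡′) = ∈-powers⁻ x∈Bi′
      in proj₁ (powers-injective {i} {i′} {e} {e′} (trans (sym x≡) x≡′))

  vsum-binaryParts : ∀ m → vsum (binaryParts m) ≡ combine v m
  vsum-binaryParts m = lookup-extensionality λ j → begin
    lookup (vsum (binaryParts m)) j                                     ≡⟨ lookup-vsum-concat-tabulate k _ j ⟩
    ΣFinℕ k (λ i → lookup (vsum (powers i (binaryExponents (m i)))) j)  ≡⟨ ΣFinℕ-cong k (λ i → cong (λ x → lookup x j) (vsum-powers i)) ⟩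
    ΣFinℕ k (λ i → lookup (m i · v i) j)                                ≡⟨ ΣFinℕ-cong k (λ i → Vecₚ.lookup-map j _ (v i)) ⟩
    ΣFinℕ k (λ i → m i * lookup (v i) j)                                ≡⟨ sym (Vecₚ.lookup∘tabulate _ j) ⟩
    lookup (combine v m) j                                              ∎
    where
    open ≡-Reasoning
    vsum-powers : ∀ i → vsum (powers i (binaryExponents (m i))) ≡ m i · v i
    vsum-powers i = begin
      vsum (powers i (binaryExponents (m i)))                 ≡⟨ cong vsum (Listₚ.map-∘ (binaryExponents (m i))) ⟩
      vsum (map (_· v i) (map (2 ^_) (binaryExponents (m i)))) ≡⟨ vsum-map-· (map (2 ^_) (binaryExponents (m i))) (v i) ⟩
      sum (map (2 ^_) (binaryExponents (m i))) · v i          ≡⟨ cong (_· v i) (sum-powers-binaryExponents (m i)) ⟩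
      m i · v i                                               ∎

  cone⊆FS : ∀ {p} → InCone v p → InFS (InX v) p
  cone⊆FS {p} p∈U =
    remainder ∷ binaryParts whole , (λ ()) , remainder∉parts ∷ binaryParts-unique whole ,
    inj₁ remainder∈S ∷ All.tabulate parts∈X , trans (cong (Vec.zipWith _+_ remainder) (vsum-binaryParts whole)) sum≡
    where
    open Decomposition (decompose v independent {p} p∈U)
    remainder∉parts : All (remainder ≢_) (binaryParts whole)
    remainder∉parts = All.tabulate λ x∈ r≡x →
      let (i , e , x≡) = ∈-binaryParts⁻ whole x∈ in remainder∉powers i e (trans r≡x x≡)
    parts∈X : ∀ {x} → x ∈ binaryParts whole → InX v x
    parts∈X x∈ = let (i , e , x≡) = ∈-binaryParts⁻ whole x∈ in inj₂ (i , e , x≡)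

module Thinness {k} (v : Fin k → Point k) (independent : LinIndep v) (nonzero : ∀ i → ∃ λ j → lookup (v i) j ≢ 0) where

  entrySum : ℕ
  entrySum = ΣFinℕ k (λ i → ΣFinℕ k (λ j → lookup (v i) j))

  entry≤entrySum : ∀ i j → lookup (v i) j ≤ entrySum
  entry≤entrySum i j = ℕₚ.≤-trans (ΣFinℕ-≥ k _ j) (ΣFinℕ-≥ k (λ i → ΣFinℕ k (λ j → lookup (v i) j)) i)

  D : ℕ
  D = k * entrySum

  candidates : ℕ → List (Point k)
  candidates ℓ =
    cube (List.upTo (suc D)) k ++ List.cartesianProductWith (λ i e → 2 ^ e · v i) (List.allFin k) (List.upTo (suc ℓ))

  length-candidates : ∀ ℓ → length (candidates ℓ) ≡ suc D ^ k + k * suc ℓ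
  length-candidates ℓ = begin
    length (candidates ℓ)                                        ≡⟨ Listₚ.length-++ (cube (List.upTo (suc D)) k) ⟩
    length (cube (List.upTo (suc D)) k) + length (List.cartesianProductWith _ (List.allFin k) (List.upTo (suc ℓ)))
      ≡⟨ cong₂ _+_ (length-cube _ k) (length-cartesianProductWith _ (List.allFin k) _) ⟩
    length (List.upTo (suc D)) ^ k + length (List.allFin k) * length (List.upTo (suc ℓ))
      ≡⟨ cong₂ (λ a b → a ^ k + b) (Listₚ.length-upTo (suc D))
           (cong₂ _*_ (Listₚ.length-tabulate {n = k} (λ i → i)) (Listₚ.length-upTo (suc ℓ))) ⟩
    suc D ^ k + k * suc ℓ                                        ∎
    where open ≡-Reasoning

  X∩box⊆candidates : ∀ N {x} → InX v x → InBox N x → x ∈ candidates ⌊log₂ N ⌋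
  X∩box⊆candidates N {x} (inj₁ x∈S) _ =
    ∈ₚ.∈-++⁺ˡ (∈-cube⁺ _ x (λ j → ∈ₚ.∈-upTo⁺ (s≤s (simplex-bounded v entry≤entrySum {x} x∈S j))))
  X∩box⊆candidates N (inj₂ (i , e , refl)) x∈box =
    ∈ₚ.∈-++⁺ʳ (cube (List.upTo (suc D)) k)
      (∈ₚ.∈-cartesianProductWith⁺ _ (∈ₚ.∈-allFin i) (∈ₚ.∈-upTo⁺ (s≤s e≤ℓ)))
    where
    j = proj₁ (nonzero i)
    2^e≤N : 2 ^ e ≤ N
    2^e≤N = begin
      2 ^ e                    ≤⟨ ℕₚ.m≤m*n (2 ^ e) (lookup (v i) j) {{ℕ.≢-nonZero (proj₂ (nonzero i))}} ⟩
      2 ^ e * lookup (v i) j   ≡⟨ sym (Vecₚ.lookup-map j _ (v i)) ⟩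
      lookup (2 ^ e · v i) j   ≤⟨ proj₂ (VAllₚ.lookup⁺ x∈box j) ⟩
      N                        ∎
      where open ℕₚ.≤-Reasoning
    e≤ℓ : e ≤ ⌊log₂ N ⌋
    e≤ℓ = 2^e≤n⇒e≤⌊log₂n⌋ 2^e≤N

  X∩box-bound : ∀ N {L} → Unique L → All (λ p → InX v p × InBox N p) L → length L ≤ suc D ^ k + k * suc ⌊log₂ N ⌋
  X∩box-bound N L! L⊆X∩box = subst (_ ≤_) (length-candidates ⌊log₂ N ⌋) (unique-⊆⇒length-≤ L! λ x∈L →
    let (x∈X , x∈box) = All.lookup L⊆X∩box x∈L in X∩box⊆candidates N x∈X x∈box)

  zero-column⇒X∩box-empty : ∀ {j} → (∀ i → lookup (v i) j ≡ 0) → ∀ N {x} → InX v x → ¬ InBox N x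
  zero-column⇒X∩box-empty {j} column≡0 N {x} x∈X x∈box =
    ℕₚ.<⇒≢ (proj₁ (VAllₚ.lookup⁺ x∈box j)) (sym (X-zero-column v column≡0 {x} x∈X))

  module Grid (covered : ∀ j → ∃ λ i → lookup (v i) j ≢ 0) (q : ℕ) where

    coefficients : List (Vec ℕ k)
    coefficients = cube (map suc (List.upTo (2 ^ q))) k

    gridPoints : List (Point k)
    gridPoints = map (combine v ∘ lookup) coefficients

    gridPoints-unique : Unique gridPoints
    gridPoints-unique = Uniqueₚ.map⁺ (lookup-extensionality ∘ combine-injective v independent)
      (cube-unique (Uniqueₚ.map⁺ ℕₚ.suc-injective (Uniqueₚ.upTo⁺ (2 ^ q))) k)

    length-gridPoints : length gridPoints ≡ 2 ^ (q * k)
    length-gridPoints = begin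
      length gridPoints                      ≡⟨ Listₚ.length-map (combine v ∘ lookup) coefficients ⟩
      length coefficients                    ≡⟨ length-cube _ k ⟩
      length (map suc (List.upTo (2 ^ q))) ^ k
        ≡⟨ cong (_^ k) (trans (Listₚ.length-map suc (List.upTo (2 ^ q))) (Listₚ.length-upTo (2 ^ q))) ⟩
      (2 ^ q) ^ k                            ≡⟨ ℕₚ.^-*-assoc 2 q k ⟩
      2 ^ (q * k)                            ∎
      where open ≡-Reasoning

    gridPoints⊆cone∩box : ∀ N → 2 ^ q * D ≤ N → All (λ p → InCone v p × InBox N p) gridPoints
    gridPoints⊆cone∩box N 2^qD≤N = Allₚ.map⁺ (All.tabulate λ {c} c∈ → in-cone c , in-box c (∈-cube⁻ _ c∈))
      where
      in-cone : ∀ c → InCone v (combine v (lookup c))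
      in-cone c = (λ i → ℕtoℚ (lookup c i)) , (λ i → ℕtoℚ-nonNeg (lookup c i)) , combine-coordinates v (lookup c)
      in-box : ∀ c → (∀ i → lookup c i ∈ map suc (List.upTo (2 ^ q))) → InBox N (combine v (lookup c))
      in-box c c∈ = VAllₚ.lookup⁻ λ j →
        subst (λ y → 1 ≤ y × y ≤ N) (sym (Vecₚ.lookup∘tabulate _ j)) (lower j , upper j)
        where
        bounds : ∀ i → 1 ≤ lookup c i × lookup c i ≤ 2 ^ q
        bounds i with y , y∈ , eq ← ∈ₚ.∈-map⁻ suc (c∈ i) rewrite eq = s≤s z≤n , ∈ₚ.∈-upTo⁻ y∈
        lower : ∀ j → 1 ≤ ΣFinℕ k (λ i → lookup c i * lookup (v i) j)
        lower j = let (i , vᵢⱼ≢0) = covered j in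
          ℕₚ.≤-trans (ℕₚ.*-mono-≤ (proj₁ (bounds i)) (ℕₚ.n≢0⇒n>0 vᵢⱼ≢0)) (ΣFinℕ-≥ k _ i)
        upper : ∀ j → ΣFinℕ k (λ i → lookup c i * lookup (v i) j) ≤ N
        upper j = begin
          ΣFinℕ k (λ i → lookup c i * lookup (v i) j)
            ≤⟨ ΣFinℕ-mono-≤ k (λ i → ℕₚ.*-mono-≤ (proj₂ (bounds i)) (entry≤entrySum i j)) ⟩
          ΣFinℕ k (λ _ → 2 ^ q * entrySum)           ≡⟨ ΣFinℕ-const k _ ⟩
          k * (2 ^ q * entrySum)                     ≡⟨ ℕₚ.*-comm k _ ⟩
          2 ^ q * entrySum * k                       ≡⟨ ℕₚ.*-assoc (2 ^ q) entrySum k ⟩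
          2 ^ q * (entrySum * k)                     ≡⟨ cong (2 ^ q *_) (ℕₚ.*-comm entrySum k) ⟩
          2 ^ q * D                                  ≤⟨ 2^qD≤N ⟩
          N                                          ∎
          where open ℕₚ.≤-Reasoning

  -- Linear independence excludes a zero column, but handling that case directly avoids determinants.
  column-dichotomy : (∀ j → ∃ λ i → lookup (v i) j ≢ 0) ⊎ (∃ λ j → ∀ i → lookup (v i) j ≡ 0)
  column-dichotomy with Finₚ.any? (λ j → Finₚ.all? (λ i → lookup (v i) j ℕ.≟ 0))
  ... | yes zero-column    = inj₂ zero-column
  ... | no  no-zero-column = inj₁ λ j →
    Finₚ.¬∀⟶∃¬ k _ (λ i → lookup (v i) j ℕ.≟ 0) (λ column≡0 → no-zero-column (j , column≡0))

  grid-fits : ∀ N → 2 ^ D ≤ N → 2 ^ (⌊log₂ N ⌋ ∸ D) * D ≤ N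
  grid-fits N 2^D≤N = begin
    2 ^ q * D      ≤⟨ ℕₚ.*-monoʳ-≤ (2 ^ q) (ℕₚ.<⇒≤ (n<2^n D)) ⟩
    2 ^ q * 2 ^ D  ≡⟨ sym (ℕₚ.^-distribˡ-+-* 2 q D) ⟩
    2 ^ (q + D)    ≡⟨ cong (2 ^_) (ℕₚ.m∸n+n≡m (2^e≤n⇒e≤⌊log₂n⌋ {D} {N} 2^D≤N)) ⟩
    2 ^ ⌊log₂ N ⌋  ≤⟨ 2^⌊log₂n⌋≤n N (ℕₚ.≤-trans (ℕₚ.m^n>0 2 D) 2^D≤N) ⟩
    N              ∎
    where
    open ℕₚ.≤-Reasoning
    q = ⌊log₂ N ⌋ ∸ D

  slack : ℕ
  slack = suc D ^ k + k * suc D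

  regroup-slack : ∀ {ℓ} → D ≤ ℓ → suc D ^ k + k * suc ℓ ≡ (ℓ ∸ D) * k + slack
  regroup-slack {ℓ} D≤ℓ = begin
    suc D ^ k + k * suc ℓ             ≡⟨ cong (λ m → suc D ^ k + k * suc m) (sym (ℕₚ.m∸n+n≡m D≤ℓ)) ⟩
    suc D ^ k + k * suc (ℓ ∸ D + D)   ≡⟨ regroup (suc D ^ k) k (ℓ ∸ D) D ⟩
    (ℓ ∸ D) * k + slack               ∎
    where
    open ≡-Reasoning
    regroup : ∀ P k q D → P + k * suc (q + D) ≡ q * k + (P + k * suc D)
    regroup = solve-∀

  thin : ∀ N → 2 ^ D ≤ N → ∀ L → Unique L → All (λ p → InX v p × InBox N p) L
    → Σ (List (Point k)) λ M → Unique M × All (λ p → InCone v p × InBox N p) M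
        × length L ≤ ⌊log₂ length M ⌋ + slack
  thin N 2^D≤N L L! L⊆X∩box with column-dichotomy
  ... | inj₂ (j , column≡0) = [] , [] , [] , no-points L⊆X∩box
    where
    no-points : ∀ {L} → All (λ p → InX v p × InBox N p) L → length L ≤ slack
    no-points []                  = z≤n
    no-points ((x∈X , x∈box) ∷ _) = ⊥-elim (zero-column⇒X∩box-empty column≡0 N x∈X x∈box)
  ... | inj₁ covered = gridPoints , gridPoints-unique , gridPoints⊆cone∩box N (grid-fits N 2^D≤N) , length-bound
    where
    open Grid covered (⌊log₂ N ⌋ ∸ D)
    length-bound : length L ≤ ⌊log₂ length gridPoints ⌋ + slack
    length-bound = begin
      length L                            ≤⟨ X∩box-bound N L! L⊆X∩box ⟩
      suc D ^ k + k * suc ⌊log₂ N ⌋       ≡⟨ regroup-slack (2^e≤n⇒e≤⌊log₂n⌋ {D} {N} 2^D≤N) ⟩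
      (⌊log₂ N ⌋ ∸ D) * k + slack         ≡⟨ cong (_+ slack) (sym log-length) ⟩
      ⌊log₂ length gridPoints ⌋ + slack   ∎
      where
      open ℕₚ.≤-Reasoning
      log-length : ⌊log₂ length gridPoints ⌋ ≡ (⌊log₂ N ⌋ ∸ D) * k
      log-length = trans (cong ⌊log₂_⌋ length-gridPoints) (⌊log₂[2^n]⌋≡n _)

theorem1p2 : (k : ℕ) (v : Fin k → Point k) → LinIndep v → (∀ i → NotAxisParallel (v i))
    → ((p : Point k) → (InCone v p → InFS (InX v) p) × (InFS (InX v) p → InCone v p))
      × Σ ℕ (λ t → Σ ℕ (λ N₀ → (N : ℕ) → N₀ ≤ N
          → (L : List (Point k)) → Unique L → All (λ p → InX v p × InBox N p) L
          → Σ (List (Point k)) (λ M → Unique M × All (λ p → InCone v p × InBox N p) M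
              × length L ≤ ⌊log₂ length M ⌋ + t)))
theorem1p2 k v independent notAxisParallel =
  (λ p → cone⊆FS v independent {p} , FS⊆cone v {p}) , slack , 2 ^ D , thin
  where
  nonzero : ∀ i → ∃ λ j → lookup (v i) j ≢ 0
  nonzero i = let (j , _ , vᵢⱼ≢0) = notAxisParallel i i in j , vᵢⱼ≢0
  open Thinness v independent nonzero
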